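{- Let $k\ge 2$ be an integer. For $n\ge 1$ put $b_n=\dfrac{\Gamma(n-1+n/k)}{n!\,\Gamma(n/k)}$, and put $$\varepsilon_k=\sum_{i\ge 1}\binom{(k+1)i-2}{i-1}\frac{1}{i\,2^{(k+1)i}}.$$ Then $$2-2k\sum_{m=1}^{\infty}\frac{b_{mk}}{2^{m(k+1)}} \;=\; 2(1-\varepsilon_k).$$
   Context: The left-hand side is the Fuss–Catalan series expression for the unique positive real root $\zeta_0$ of $x^k-x^{k-1}-\dots-x-1$, and the right-hand side is Wolfram's expression $\zeta_0=2(1-\varepsilon_k)$ for the same root. -}

module Defs where

open import Data.Nat as ℕ using (ℕ; zero; suc; _∸_; _^_; _!)
open import Data.Nat.Combinatorics using (_C_)
open import Data.Integer using (+_)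
open import Data.Rational using (ℚ; 0ℚ; 1ℚ; _+_; _*_; _-_; ∣_∣; _<_; _/_)
open import Data.Product using (∃)

-- the rational number n / d (with the convention n / 0 := 0; only used with d ≥ 1)
frac : ℕ → ℕ → ℚ
frac n zero    = 0ℚ
frac n (suc d) = (+ n) / suc d

ℕ→ℚ : ℕ → ℚ
ℕ→ℚ n = frac n 1

-- rising factorial x (x+1) ... (x+j-1) = Γ(x+j)/Γ(x)
rising : ℚ → ℕ → ℚ
rising x zero    = 1ℚ
rising x (suc j) = rising x j * (x + ℕ→ℚ j)

-- b_n = Γ(n-1+n/k) / (n! Γ(n/k)) = (n/k)_{(n-1)} / n!   (for n ≥ 1)
b : ℕ → ℕ → ℚ
b k n = rising (frac n k) (n ∸ 1) * frac 1 (n !)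

sum1 : (ℕ → ℚ) → ℕ → ℚ
sum1 f zero    = 0ℚ
sum1 f (suc N) = sum1 f N + f (suc N)

lhsPartial : ℕ → ℕ → ℚ
lhsPartial k N =
  ℕ→ℚ 2 - ℕ→ℚ (2 ℕ.* k) * sum1 (λ m → b k (m ℕ.* k) * frac 1 (2 ^ (m ℕ.* (k ℕ.+ 1)))) N

epsPartial : ℕ → ℕ → ℚ
epsPartial k N =
  sum1 (λ i → frac (((k ℕ.+ 1) ℕ.* i ∸ 2) C (i ∸ 1)) (i ℕ.* 2 ^ ((k ℕ.+ 1) ℕ.* i))) N

rhsPartial : ℕ → ℕ → ℚ
rhsPartial k N = ℕ→ℚ 2 * (1ℚ - epsPartial k N)

-- a rational sequence is Cauchy (i.e. converges to a real number)
IsCauchy : (ℕ → ℚ) → Set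
IsCauchy s = ∀ ε → 0ℚ < ε → ∃ λ N → ∀ m n → N ℕ.≤ m → N ℕ.≤ n → ∣ s m - s n ∣ < ε

SameLimit : (ℕ → ℚ) → (ℕ → ℚ) → Set
SameLimit s t = ∀ ε → 0ℚ < ε → ∃ λ N → ∀ n → N ℕ.≤ n → ∣ s n - t n ∣ < ε

{-# OPTIONS --safe #-}
-- For m ≥ 1 the rising factorial in b_{mk} is a ratio of factorials,
-- (m)_{mk-1} = (mk+m-2)!/(m-1)!, so k b_{mk} = (1/m) C((k+1)m-2, m-1) is a Fuss–Catalan
-- number. Hence the m-th term of the left-hand series is exactly twice the m-th term of ε_k,
-- and the two partial sums are equal.
-- For convergence, put n = (k+1)i - 2 and t = i - 1. When k ≥ 2 we have n ≥ 3t + 1, so at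
-- least t + 2 of the coefficients C(n, j) have t ≤ j ≤ n - t. Each of them is at least
-- C(n, t), and together they sum to at most 2^n. This bounds twice the i-th term of ε_k by
-- 1/(i(i+1)), and these bounds telescope.
module Submission where

open import Defs

module Binomial where

  open import Data.Nat
  open import Data.Nat.Properties
  open import Data.Nat.Combinatorics
    using (_C_; nCk+nC[k+1]≡[n+1]C[k+1]; k>n⇒nCk≡0; nCk≡n!/k![n-k]!; k![n∸k]!∣n!)
  open import Data.Nat.DivMod using (m/n*n≡m)
  open import Data.Nat.Tactic.RingSolver using (solve-∀)
  open import Algebra.Properties.CommutativeSemigroup +-commutativeSemigroup using (interchange)
  open import Data.Sum using (inj₁; inj₂)
  open import Relation.Binary.PropositionalEquality

  rowSegment : ℕ → ℕ → ℕ → ℕ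
  rowSegment n a zero    = 0
  rowSegment n a (suc L) = n C a + rowSegment n (suc a) L

  rowSegment-beyond : ∀ {n a} L → n < a → rowSegment n a L ≡ 0
  rowSegment-beyond zero    n<a = refl
  rowSegment-beyond (suc L) n<a =
    cong₂ _+_ (k>n⇒nCk≡0 n<a) (rowSegment-beyond L (m<n⇒m<1+n n<a))

  rowSegment-pascal : ∀ n a L →
    rowSegment (suc n) (suc a) L ≡ rowSegment n a L + rowSegment n (suc a) L
  rowSegment-pascal n a zero    = refl
  rowSegment-pascal n a (suc L) = begin
    suc n C suc a + rowSegment (suc n) (suc (suc a)) L
      ≡⟨ cong₂ _+_ (sym (nCk+nC[k+1]≡[n+1]C[k+1] n a)) (rowSegment-pascal n (suc a) L) ⟩
    (n C a + n C suc a) + (rowSegment n (suc a) L + rowSegment n (suc (suc a)) L)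
      ≡⟨ interchange (n C a) _ _ _ ⟩
    rowSegment n a (suc L) + rowSegment n (suc a) (suc L) ∎
    where open ≡-Reasoning

  rowSegment≤2^n : ∀ n a L → rowSegment n a L ≤ 2 ^ n
  rowSegment≤2^n zero    zero    zero    = z≤n
  rowSegment≤2^n zero    zero    (suc L) = ≤-reflexive (cong suc (rowSegment-beyond L z<s))
  rowSegment≤2^n zero    (suc a) L       = ≤-trans (≤-reflexive (rowSegment-beyond L z<s)) z≤n
  rowSegment≤2^n (suc n) zero    zero    = z≤n
  rowSegment≤2^n (suc n) zero    (suc L) = begin
    1 + rowSegment (suc n) 1 L
      ≡⟨ cong suc (rowSegment-pascal n 0 L) ⟩
    1 + (rowSegment n 0 L + rowSegment n 1 L)
      ≡⟨ cong suc (+-comm (rowSegment n 0 L) _) ⟩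
    rowSegment n 0 (suc L) + rowSegment n 0 L
      ≤⟨ +-mono-≤ (rowSegment≤2^n n 0 (suc L)) (rowSegment≤2^n n 0 L) ⟩
    2 ^ n + 2 ^ n
      ≡⟨ cong (2 ^ n +_) (sym (+-identityʳ (2 ^ n))) ⟩
    2 ^ suc n ∎
    where open ≤-Reasoning
  rowSegment≤2^n (suc n) (suc a) L = begin
    rowSegment (suc n) (suc a) L
      ≡⟨ rowSegment-pascal n a L ⟩
    rowSegment n a L + rowSegment n (suc a) L
      ≤⟨ +-mono-≤ (rowSegment≤2^n n a L) (rowSegment≤2^n n (suc a) L) ⟩
    2 ^ n + 2 ^ n
      ≡⟨ cong (2 ^ n +_) (sym (+-identityʳ (2 ^ n))) ⟩
    2 ^ suc n ∎
    where open ≤-Reasoning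

  nCt≤nCj : ∀ {n t j} → t ≤ j → t + j ≤ n → n C t ≤ n C j
  nCt≤nCj {zero}  {zero}  {zero}  _ _ = ≤-refl
  nCt≤nCj {suc n} {zero}  {zero}  _ _ = ≤-refl
  nCt≤nCj {suc n} {zero}  {suc j} _ (s≤s j≤n) = begin
    1                       ≤⟨ nCt≤nCj {n} {0} {j} z≤n j≤n ⟩
    n C j                   ≤⟨ m≤m+n (n C j) _ ⟩
    n C j + n C suc j       ≡⟨ nCk+nC[k+1]≡[n+1]C[k+1] n j ⟩
    suc n C suc j           ∎
    where open ≤-Reasoning
  nCt≤nCj {suc n} {suc t} {suc j} (s≤s t≤j) (s≤s t+1+j≤n) with m≤n⇒m<n∨m≡n t≤j
  ... | inj₂ refl = ≤-refl
  ... | inj₁ t<j = begin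
    -- Pascal's rule on both sides, pairing C(n,t) with C(n,j+1) and C(n,t+1) with C(n,j).
    suc n C suc t           ≡⟨ nCk+nC[k+1]≡[n+1]C[k+1] n t ⟨
    n C t + n C suc t       ≤⟨ +-mono-≤ (nCt≤nCj (m≤n⇒m≤1+n t≤j) t+1+j≤n)
                                        (nCt≤nCj t<j (≤-trans (≤-reflexive (sym (+-suc t j))) t+1+j≤n)) ⟩
    n C suc j + n C j       ≡⟨ +-comm (n C suc j) _ ⟩
    n C j + n C suc j       ≡⟨ nCk+nC[k+1]≡[n+1]C[k+1] n j ⟩
    suc n C suc j           ∎
    where open ≤-Reasoning

  L*nCt≤rowSegment : ∀ {n t a} L → t ≤ a → t + (a + L) ≤ suc n → L * (n C t) ≤ rowSegment n a L
  L*nCt≤rowSegment zero    _   _ = z≤n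
  L*nCt≤rowSegment {n} {t} {a} (suc L) t≤a bound =
    +-mono-≤ (nCt≤nCj t≤a t+a≤n) (L*nCt≤rowSegment L (m≤n⇒m≤1+n t≤a) bound′)
    where
    bound′ : t + (suc a + L) ≤ suc n
    bound′ = subst (λ x → t + x ≤ suc n) (+-suc a L) bound
    t+a≤n : t + a ≤ n
    t+a≤n = s≤s⁻¹ (≤-trans (m≤m+n (suc (t + a)) L) (≤-trans (≤-reflexive (reassoc t a L)) bound))
      where
      reassoc : ∀ t a L → suc (t + a) + L ≡ t + (a + suc L)
      reassoc = solve-∀

  L*nCt≤2^n : ∀ n t L → t + (t + L) ≤ suc n → L * (n C t) ≤ 2 ^ n
  L*nCt≤2^n n t L bound = ≤-trans (L*nCt≤rowSegment L ≤-refl bound) (rowSegment≤2^n n t L)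

  fussCatalan-numerator-bound : ∀ {k} t → 2 ≤ k →
    2 * (suc t + 1) * (((k + 1) * suc t ∸ 2) C t) ≤ 2 ^ ((k + 1) * suc t)
  fussCatalan-numerator-bound {k} t 2≤k = begin
    2 * (suc t + 1) * (n C t)  ≡⟨ rearrange t (n C t) ⟩
    2 * ((t + 2) * (n C t))    ≤⟨ *-monoʳ-≤ 2 (L*nCt≤2^n n t (t + 2) room) ⟩
    2 * 2 ^ n                  ≤⟨ *-monoˡ-≤ (2 ^ n) (m≤m+n 2 2) ⟩
    4 * 2 ^ n                  ≡⟨ *-comm 4 (2 ^ n) ⟩
    2 ^ n * 2 ^ 2              ≡⟨ ^-distribˡ-+-* 2 n 2 ⟨
    2 ^ (n + 2)                ≡⟨ cong (2 ^_) (m∸n+n≡m 2≤e) ⟩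
    2 ^ e                      ∎
    where
    open ≤-Reasoning
    e = (k + 1) * suc t
    n = e ∸ 2
    3[1+t]≤e : 3 * suc t ≤ e
    3[1+t]≤e = *-monoˡ-≤ (suc t) (+-monoˡ-≤ 1 2≤k)
    2≤e : 2 ≤ e
    2≤e = ≤-trans (n≤1+n 2) (≤-trans (m≤m*n 3 (suc t)) 3[1+t]≤e)
    rearrange : ∀ t c → 2 * (suc t + 1) * c ≡ 2 * ((t + 2) * c)
    rearrange = solve-∀
    3[1+t]-expanded : ∀ t → suc (t + (t + (t + 2))) ≡ 3 * suc t
    3[1+t]-expanded = solve-∀
    room : t + (t + (t + 2)) ≤ suc n
    room = s≤s⁻¹ (begin
      suc (t + (t + (t + 2)))  ≡⟨ 3[1+t]-expanded t ⟩
      3 * suc t                ≤⟨ 3[1+t]≤e ⟩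
      e                        ≡⟨ m∸n+n≡m 2≤e ⟨
      n + 2                    ≡⟨ +-comm n 2 ⟩
      suc (suc n)              ∎)

  nCk*k!*[n∸k]!≡n! : ∀ {n k} → k ≤ n → (n C k) * (k ! * (n ∸ k) !) ≡ n !
  nCk*k!*[n∸k]!≡n! {n} {k} k≤n =
    trans (cong (_* (k ! * (n ∸ k) !)) (nCk≡n!/k![n-k]! k≤n)) (m/n*n≡m {{k !* (n ∸ k) !≢0}} (k![n∸k]!∣n! k≤n))

  [m+n]Cm*m!*n!≡[m+n]! : ∀ m n → ((m + n) C m) * (m ! * n !) ≡ (m + n) !
  [m+n]Cm*m!*n!≡[m+n]! m n =
    subst (λ x → ((m + n) C m) * (m ! * x !) ≡ (m + n) !) (m+n∸m≡n m n) (nCk*k!*[n∸k]!≡n! (m≤m+n m n))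

module Fraction where

  open import Data.Nat as ℕ using (ℕ; zero; suc; NonZero)
  open import Data.Nat.Tactic.RingSolver using (solve-∀)
  open import Data.Integer as ℤ using (+_)
  import Data.Integer.Properties as ℤ
  open import Data.Rational using (0ℚ; _+_; _*_; _≤_; _<_)
  open import Data.Rational.Properties
    using ( toℚᵘ-injective; toℚᵘ-fromℚᵘ; fromℚᵘ-cong; toℚᵘ-homo-+; toℚᵘ-homo-*
          ; toℚᵘ-cancel-≤; toℚᵘ-cancel-<; ≤-refl)
  open import Data.Rational.Unnormalised as ℚᵘ using (mkℚᵘ; *≡*; *≤*; *<*)
  import Data.Rational.Unnormalised.Properties as ℚᵘ
  open import Relation.Binary.PropositionalEquality

  -- frac a (suc d) reduces to fromℚᵘ (mkℚᵘ (+ a) d), so each identity is checked in ℚᵘ.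
  frac-cong : ∀ a b c d .{{_ : NonZero b}} .{{_ : NonZero d}} →
              a ℕ.* d ≡ c ℕ.* b → frac a b ≡ frac c d
  frac-cong a (suc b) c (suc d) eq = fromℚᵘ-cong {mkℚᵘ (+ a) b} {mkℚᵘ (+ c) d}
    (*≡* (trans (sym (ℤ.pos-* a (suc d))) (trans (cong +_ eq) (ℤ.pos-* c (suc b)))))

  frac-* : ∀ a b c d .{{_ : NonZero b}} .{{_ : NonZero d}} →
           frac a b * frac c d ≡ frac (a ℕ.* c) (b ℕ.* d)
  frac-* a (suc b) c (suc d) = toℚᵘ-injective
    (ℚᵘ.≃-trans (toℚᵘ-homo-* (frac a (suc b)) (frac c (suc d)))
    (ℚᵘ.≃-trans (ℚᵘ.*-cong (toℚᵘ-fromℚᵘ (mkℚᵘ (+ a) b)) (toℚᵘ-fromℚᵘ (mkℚᵘ (+ c) d)))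
    (ℚᵘ.≃-trans (ℚᵘ.≃-reflexive (cong (λ z → mkℚᵘ z (d ℕ.+ b ℕ.* suc d)) (sym (ℤ.pos-* a c))))
                (ℚᵘ.≃-sym (toℚᵘ-fromℚᵘ (mkℚᵘ (+ (a ℕ.* c)) (d ℕ.+ b ℕ.* suc d)))))))

  frac-+ : ∀ a b c d .{{_ : NonZero b}} .{{_ : NonZero d}} →
           frac a b + frac c d ≡ frac (a ℕ.* d ℕ.+ c ℕ.* b) (b ℕ.* d)
  frac-+ a (suc b) c (suc d) = toℚᵘ-injective
    (ℚᵘ.≃-trans (toℚᵘ-homo-+ (frac a (suc b)) (frac c (suc d)))
    (ℚᵘ.≃-trans (ℚᵘ.+-cong (toℚᵘ-fromℚᵘ (mkℚᵘ (+ a) b)) (toℚᵘ-fromℚᵘ (mkℚᵘ (+ c) d)))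
    (ℚᵘ.≃-trans (ℚᵘ.≃-reflexive (cong (λ z → mkℚᵘ z (d ℕ.+ b ℕ.* suc d)) (sym numerator)))
                (ℚᵘ.≃-sym (toℚᵘ-fromℚᵘ (mkℚᵘ (+ (a ℕ.* suc d ℕ.+ c ℕ.* suc b)) (d ℕ.+ b ℕ.* suc d)))))))
    where
    numerator : + (a ℕ.* suc d ℕ.+ c ℕ.* suc b) ≡ + a ℤ.* + suc d ℤ.+ + c ℤ.* + suc b
    numerator = trans (ℤ.pos-+ (a ℕ.* suc d) (c ℕ.* suc b)) (cong₂ ℤ._+_ (ℤ.pos-* a (suc d)) (ℤ.pos-* c (suc b)))

  frac-mono-≤ : ∀ a b c d .{{_ : NonZero b}} .{{_ : NonZero d}} →
                a ℕ.* d ℕ.≤ c ℕ.* b → frac a b ≤ frac c d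
  frac-mono-≤ a (suc b) c (suc d) ad≤cb = toℚᵘ-cancel-≤
    (ℚᵘ.≤-respˡ-≃ (ℚᵘ.≃-sym (toℚᵘ-fromℚᵘ (mkℚᵘ (+ a) b)))
    (ℚᵘ.≤-respʳ-≃ (ℚᵘ.≃-sym (toℚᵘ-fromℚᵘ (mkℚᵘ (+ c) d)))
      (*≤* (subst₂ ℤ._≤_ (ℤ.pos-* a (suc d)) (ℤ.pos-* c (suc b)) (ℤ.+≤+ ad≤cb)))))

  frac-mono-< : ∀ a b c d .{{_ : NonZero b}} .{{_ : NonZero d}} →
                a ℕ.* d ℕ.< c ℕ.* b → frac a b < frac c d
  frac-mono-< a (suc b) c (suc d) ad<cb = toℚᵘ-cancel-<
    (ℚᵘ.<-respˡ-≃ (ℚᵘ.≃-sym (toℚᵘ-fromℚᵘ (mkℚᵘ (+ a) b)))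
    (ℚᵘ.<-respʳ-≃ (ℚᵘ.≃-sym (toℚᵘ-fromℚᵘ (mkℚᵘ (+ c) d)))
      (*<* (subst₂ ℤ._<_ (ℤ.pos-* a (suc d)) (ℤ.pos-* c (suc b)) (ℤ.+<+ ad<cb)))))

  0≤frac : ∀ a d → 0ℚ ≤ frac a d
  0≤frac a zero    = ≤-refl
  0≤frac a (suc d) = frac-mono-≤ 0 1 a (suc d) ℕ.z≤n

  ℕ→ℚ-+ : ∀ m n → ℕ→ℚ (m ℕ.+ n) ≡ ℕ→ℚ m + ℕ→ℚ n
  ℕ→ℚ-+ m n = sym (trans (frac-+ m 1 n 1) (frac-cong (m ℕ.* 1 ℕ.+ n ℕ.* 1) 1 (m ℕ.+ n) 1 (unit m n)))
    where
    unit : ∀ m n → (m ℕ.* 1 ℕ.+ n ℕ.* 1) ℕ.* 1 ≡ (m ℕ.+ n) ℕ.* 1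
    unit = solve-∀

  ℕ→ℚ-* : ∀ m n → ℕ→ℚ (m ℕ.* n) ≡ ℕ→ℚ m * ℕ→ℚ n
  ℕ→ℚ-* m n = sym (frac-* m 1 n 1)

module Series where

  open Fraction
  open import Data.Nat as ℕ using (ℕ; zero; suc; _≤′_; ≤′-refl; ≤′-step)
  import Data.Nat.Properties as ℕ
  open import Data.Nat.Tactic.RingSolver using (solve-∀)
  open import Data.Integer as ℤ using (+0; +[1+_]; -[1+_])
  open import Data.Rational using (ℚ; mkℚ; 0ℚ; _+_; _*_; _-_; -_; ∣_∣; _≤_; _<_; _≥_; *<*)
  open import Data.Rational.Properties
  open import Data.Rational.Solver using (module +-*-Solver)
  open import Data.Product using (_×_; _,_; ∃)
  open import Data.Sum using (inj₁; inj₂)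
  open import Function using (_∘_; flip)
  open import Relation.Binary.Core using (Rel)
  open import Relation.Binary.Definitions using (Reflexive; Transitive)
  open import Relation.Binary.PropositionalEquality

  sum1-cong : ∀ {f g} → f ∘ suc ≗ g ∘ suc → sum1 f ≗ sum1 g
  sum1-cong f≗g zero    = refl
  sum1-cong f≗g (suc N) = cong₂ _+_ (sum1-cong f≗g N) (f≗g N)

  *-distribˡ-sum1 : ∀ c f N → c * sum1 f N ≡ sum1 (λ i → c * f i) N
  *-distribˡ-sum1 c f zero    = *-zeroʳ c
  *-distribˡ-sum1 c f (suc N) =
    trans (*-distribˡ-+ c (sum1 f N) (f (suc N))) (cong (_+ c * f (suc N)) (*-distribˡ-sum1 c f N))

  module _ {a ℓ} {A : Set a} {_∼_ : Rel A ℓ} (refl′ : Reflexive _∼_) (trans′ : Transitive _∼_)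
           (f : ℕ → A) (step : ∀ n → f n ∼ f (suc n)) where

    mono-by-steps : ∀ {m n} → m ≤′ n → f m ∼ f n
    mono-by-steps {m} ≤′-refl            = refl′ {f m}
    mono-by-steps {m} (≤′-step {n} m≤′n) = trans′ {f m} {f n} {f (suc n)} (mono-by-steps m≤′n) (step n)

  p≤p+q : ∀ {p q} → 0ℚ ≤ q → p ≤ p + q
  p≤p+q {p} 0≤q = subst (_≤ p + _) (+-identityʳ p) (+-monoʳ-≤ p 0≤q)

  u-v≤c : ∀ {x u v c} → u ≤ x + c → x ≤ v → u - v ≤ c
  u-v≤c {x} {u} {v} {c} u≤x+c x≤v = subst (u - v ≤_) (x+c-x≡c x c) (+-mono-≤ u≤x+c (neg-antimono-≤ x≤v))
    where
    x+c-x≡c : ∀ x c → (x + c) - x ≡ c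
    x+c-x≡c = solve 2 (λ x c → (x :+ c) :- x := c) refl where open +-*-Solver

  ∣y-z∣≤c : ∀ {x y z c} → x ≤ y → y ≤ x + c → x ≤ z → z ≤ x + c → ∣ y - z ∣ ≤ c
  ∣y-z∣≤c {x} {y} {z} {c} x≤y y≤x+c x≤z z≤x+c with ∣p∣≡p∨∣p∣≡-p (y - z)
  ... | inj₁ ∣y-z∣≡y-z  = subst (_≤ c) (sym ∣y-z∣≡y-z) (u-v≤c y≤x+c x≤z)
  ... | inj₂ ∣y-z∣≡-[y-z] = subst (_≤ c) (sym (trans ∣y-z∣≡-[y-z] (-[y-z]≡z-y y z))) (u-v≤c z≤x+c x≤y)
    where
    -[y-z]≡z-y : ∀ y z → - (y - z) ≡ z - y
    -[y-z]≡z-y = solve 2 (λ y z → :- (y :- z) := z :- y) refl where open +-*-Solver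

  1/[1+j][2+j]+1/[2+j]≡1/[1+j] : ∀ j →
    frac 1 (suc j ℕ.* suc (suc j)) + frac 1 (suc (suc j)) ≡ frac 1 (suc j)
  1/[1+j][2+j]+1/[2+j]≡1/[1+j] j = trans
    (frac-+ 1 (suc j ℕ.* suc (suc j)) 1 (suc (suc j)))
    (frac-cong (1 ℕ.* suc (suc j) ℕ.+ 1 ℕ.* (suc j ℕ.* suc (suc j))) (suc j ℕ.* suc (suc j) ℕ.* suc (suc j))
               1 (suc j) (cross-multiplied j))
    where
    cross-multiplied : ∀ j → (1 ℕ.* suc (suc j) ℕ.+ 1 ℕ.* (suc j ℕ.* suc (suc j))) ℕ.* suc j
                           ≡ 1 ℕ.* (suc j ℕ.* suc (suc j) ℕ.* suc (suc j))
    cross-multiplied = solve-∀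

  archimedean : ∀ {ε} → 0ℚ < ε → ∃ λ N → frac 1 (suc N) < ε
  archimedean {ε@(mkℚ +[1+ p ] q _)} _ = suc q ,
    subst (frac 1 (suc (suc q)) <_) (fromℚᵘ-toℚᵘ ε)
      (frac-mono-< 1 (suc (suc q)) (suc p) (suc q)
        (ℕ.≤-trans (ℕ.≤-reflexive (cong suc (ℕ.*-identityˡ (suc q)))) (ℕ.m≤n*m (suc (suc q)) (suc p))))
  archimedean {mkℚ +0       _ _} (*<* (ℤ.+<+ ()))
  archimedean {mkℚ -[1+ _ ] _ _} (*<* ())

  module _ (a : ℕ → ℚ) (a≥0 : ∀ j → 0ℚ ≤ a (suc j))
           (a≤ : ∀ j → a (suc j) ≤ frac 1 (suc j ℕ.* suc (suc j))) where

    private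
      S : ℕ → ℚ
      S = sum1 a

      envelope : ℕ → ℚ
      envelope n = S n + frac 1 (suc n)

      envelope-step : ∀ n → envelope (suc n) ≤ envelope n
      envelope-step n = begin
        S n + a (suc n) + frac 1 (suc (suc n))
          ≡⟨ +-assoc (S n) _ _ ⟩
        S n + (a (suc n) + frac 1 (suc (suc n)))
          ≤⟨ +-monoʳ-≤ (S n) (+-monoˡ-≤ _ (a≤ n)) ⟩
        S n + (frac 1 (suc n ℕ.* suc (suc n)) + frac 1 (suc (suc n)))
          ≡⟨ cong (S n +_) (1/[1+j][2+j]+1/[2+j]≡1/[1+j] n) ⟩
        S n + frac 1 (suc n) ∎
        where open ≤-Reasoning

      sum1-window : ∀ {N n} → N ℕ.≤ n → S N ≤ S n × S n ≤ S N + frac 1 (suc N)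
      sum1-window {N} {n} N≤n =
          mono-by-steps {_∼_ = _≤_} ≤-refl ≤-trans S (λ j → p≤p+q (a≥0 j)) (ℕ.≤⇒≤′ N≤n)
        , ≤-trans (p≤p+q (0≤frac 1 (suc n)))
                  (mono-by-steps {_∼_ = _≥_} ≤-refl (flip ≤-trans) envelope envelope-step (ℕ.≤⇒≤′ N≤n))

    sum1-isCauchy : IsCauchy (sum1 a)
    sum1-isCauchy ε ε>0 with archimedean ε>0
    ... | N , 1/[1+N]<ε = N , λ m n N≤m N≤n →
      let S[N]≤S[m] , S[m]≤ = sum1-window N≤m
          S[N]≤S[n] , S[n]≤ = sum1-window N≤n
      in ≤-<-trans (∣y-z∣≤c S[N]≤S[m] S[m]≤ S[N]≤S[n] S[n]≤) 1/[1+N]<ε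

  IsCauchy-cong : ∀ {s t} → s ≗ t → IsCauchy s → IsCauchy t
  IsCauchy-cong s≗t cauchy ε ε>0 with cauchy ε ε>0
  ... | N , close = N , λ m n N≤m N≤n →
    subst₂ (λ x y → ∣ x - y ∣ < ε) (s≗t m) (s≗t n) (close m n N≤m N≤n)

  IsCauchy-const-minus : ∀ c {s} → IsCauchy s → IsCauchy (λ n → c - s n)
  IsCauchy-const-minus c {s} cauchy ε ε>0 with cauchy ε ε>0
  ... | N , close = N , λ m n N≤m N≤n →
    subst (λ x → ∣ x ∣ < ε) (sym (c-x-[c-y]≡y-x c (s m) (s n))) (close n m N≤n N≤m)
    where
    c-x-[c-y]≡y-x : ∀ c x y → (c - x) - (c - y) ≡ y - x
    c-x-[c-y]≡y-x = solve 3 (λ c x y → (c :- x) :- (c :- y) := y :- x) refl where open +-*-Solver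

  ≗⇒SameLimit : ∀ {s t} → s ≗ t → SameLimit s t
  ≗⇒SameLimit {s} s≗t ε ε>0 = 0 , λ n _ →
    subst (λ x → ∣ x ∣ < ε) (sym (trans (cong (λ x → s n - x) (sym (s≗t n))) (+-inverseʳ (s n)))) ε>0

module FussCatalan where

  open Binomial using ([m+n]Cm*m!*n!≡[m+n]!; fussCatalan-numerator-bound)
  open Fraction
  open Series
  open import Data.Nat as ℕ using (ℕ; zero; suc; _∸_; _^_; _!)
  import Data.Nat.Properties as ℕ
  open import Data.Nat.Combinatorics using (_C_)
  open import Data.Nat.Tactic.RingSolver using (solve-∀)
  open import Data.Rational using (ℚ; 0ℚ; 1ℚ; _+_; _*_; _-_; -_; _≤_)
  open import Data.Rational.Properties
  open import Data.Rational.Solver using (module +-*-Solver)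
  open import Function using (_∘_)
  open import Relation.Binary.PropositionalEquality

  rising-ℕ→ℚ : ∀ m j → rising (ℕ→ℚ (suc m)) j ≡ frac ((m ℕ.+ j) !) (m !)
  rising-ℕ→ℚ m zero    = frac-cong 1 1 ((m ℕ.+ 0) !) (m !) {{_}} {{m ℕ.!≢0}}
    (trans (ℕ.*-identityˡ (m !)) (sym (trans (ℕ.*-identityʳ _) (cong _! (ℕ.+-identityʳ m)))))
  rising-ℕ→ℚ m (suc j) = begin
    rising (ℕ→ℚ (suc m)) j * (ℕ→ℚ (suc m) + ℕ→ℚ j)
      ≡⟨ cong₂ _*_ (rising-ℕ→ℚ m j) (sym (ℕ→ℚ-+ (suc m) j)) ⟩
    frac ((m ℕ.+ j) !) (m !) * ℕ→ℚ (suc m ℕ.+ j)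
      ≡⟨ frac-* ((m ℕ.+ j) !) (m !) (suc m ℕ.+ j) 1 ⟩
    frac ((m ℕ.+ j) ! ℕ.* suc (m ℕ.+ j)) (m ! ℕ.* 1)
      ≡⟨ frac-cong _ (m ! ℕ.* 1) _ (m !) (rearrange ((m ℕ.+ j) !) (m ℕ.+ j) (m !)) ⟩
    frac (suc (m ℕ.+ j) !) (m !)
      ≡⟨ cong (λ x → frac (x !) (m !)) (ℕ.+-suc m j) ⟨
    frac ((m ℕ.+ suc j) !) (m !) ∎
    where
    open ≡-Reasoning
    instance
      _ = m ℕ.!≢0
      _ = ℕ.m*n≢0 (m !) 1
    rearrange : ∀ X n F → X ℕ.* suc n ℕ.* F ≡ (suc n ℕ.* X) ℕ.* (F ℕ.* 1)
    rearrange = solve-∀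

  epsTerm : ℕ → ℕ → ℚ
  epsTerm k i = frac (((k ℕ.+ 1) ℕ.* i ∸ 2) C (i ∸ 1)) (i ℕ.* 2 ^ ((k ℕ.+ 1) ℕ.* i))

  k*b[mk]≡fussCatalan : ∀ k m →
    ℕ→ℚ (suc k) * b (suc k) (suc m ℕ.* suc k) ≡ frac (((suc k ℕ.+ 1) ℕ.* suc m ∸ 2) C m) (suc m)
  k*b[mk]≡fussCatalan k m = begin
    ℕ→ℚ K * (rising (frac (suc m ℕ.* K) K) j * frac 1 (suc j !))
      ≡⟨ cong (λ x → ℕ→ℚ K * (rising x j * frac 1 (suc j !)))
              (frac-cong (suc m ℕ.* K) K (suc m) 1 (ℕ.*-identityʳ _)) ⟩
    ℕ→ℚ K * (rising (ℕ→ℚ (suc m)) j * frac 1 (suc j !))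
      ≡⟨ cong (λ x → ℕ→ℚ K * (x * frac 1 (suc j !))) (rising-ℕ→ℚ m j) ⟩
    ℕ→ℚ K * (frac ((m ℕ.+ j) !) (m !) * frac 1 (suc j !))
      ≡⟨ cong (ℕ→ℚ K *_) (frac-* ((m ℕ.+ j) !) (m !) 1 (suc j !)) ⟩
    ℕ→ℚ K * frac ((m ℕ.+ j) ! ℕ.* 1) (m ! ℕ.* suc j !)
      ≡⟨ frac-* K 1 ((m ℕ.+ j) ! ℕ.* 1) (m ! ℕ.* suc j !) ⟩
    frac (K ℕ.* ((m ℕ.+ j) ! ℕ.* 1)) (1 ℕ.* (m ! ℕ.* suc j !))
      ≡⟨ frac-cong _ (1 ℕ.* (m ! ℕ.* suc j !)) ((m ℕ.+ j) C m) (suc m) cross-multiplied ⟩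
    frac ((m ℕ.+ j) C m) (suc m)
      ≡⟨ cong (λ n → frac (n C m) (suc m)) index ⟨
    frac (((K ℕ.+ 1) ℕ.* suc m ∸ 2) C m) (suc m) ∎
    where
    open ≡-Reasoning
    K = suc k
    -- j = mk - 1: suc j reduces to suc m * K, which is how b K (suc m * K) unfolds above.
    j = k ℕ.+ m ℕ.* K
    instance
      _ = m ℕ.!≢0
      _ = suc j ℕ.!≢0
      _ = ℕ.m*n≢0 (m !) (suc j !)
      _ = ℕ.m*n≢0 1 (m ! ℕ.* suc j !)
    index : (K ℕ.+ 1) ℕ.* suc m ∸ 2 ≡ m ℕ.+ j
    index = cong (_∸ 2) (expand k m)
      where
      expand : ∀ k m → (suc k ℕ.+ 1) ℕ.* suc m ≡ 2 ℕ.+ (m ℕ.+ (k ℕ.+ m ℕ.* suc k))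
      expand = solve-∀
    cross-multiplied : K ℕ.* ((m ℕ.+ j) ! ℕ.* 1) ℕ.* suc m ≡ ((m ℕ.+ j) C m) ℕ.* (1 ℕ.* (m ! ℕ.* suc j !))
    cross-multiplied = begin
      K ℕ.* ((m ℕ.+ j) ! ℕ.* 1) ℕ.* suc m           ≡⟨ shuffle₁ K ((m ℕ.+ j) !) m ⟩
      suc m ℕ.* K ℕ.* (m ℕ.+ j) !                   ≡⟨ cong (suc m ℕ.* K ℕ.*_) ([m+n]Cm*m!*n!≡[m+n]! m j) ⟨
      suc j ℕ.* (((m ℕ.+ j) C m) ℕ.* (m ! ℕ.* j !))  ≡⟨ shuffle₂ (suc j) ((m ℕ.+ j) C m) (m !) (j !) ⟩
      ((m ℕ.+ j) C m) ℕ.* (1 ℕ.* (m ! ℕ.* (suc j ℕ.* j !))) ∎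
      where
      shuffle₁ : ∀ K X m → K ℕ.* (X ℕ.* 1) ℕ.* suc m ≡ suc m ℕ.* K ℕ.* X
      shuffle₁ = solve-∀
      shuffle₂ : ∀ s C F J → s ℕ.* (C ℕ.* (F ℕ.* J)) ≡ C ℕ.* (1 ℕ.* (F ℕ.* (s ℕ.* J)))
      shuffle₂ = solve-∀

  k*b[mk]/2^[m[k+1]]≡epsTerm : ∀ k m →
    ℕ→ℚ (suc k) * (b (suc k) (suc m ℕ.* suc k) * frac 1 (2 ^ (suc m ℕ.* (suc k ℕ.+ 1))))
      ≡ epsTerm (suc k) (suc m)
  k*b[mk]/2^[m[k+1]]≡epsTerm k m = begin
    ℕ→ℚ K * (b K (suc m ℕ.* K) * frac 1 (2 ^ e))
      ≡⟨ *-assoc (ℕ→ℚ K) _ _ ⟨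
    ℕ→ℚ K * b K (suc m ℕ.* K) * frac 1 (2 ^ e)
      ≡⟨ cong (_* frac 1 (2 ^ e)) (k*b[mk]≡fussCatalan k m) ⟩
    frac c (suc m) * frac 1 (2 ^ e)
      ≡⟨ frac-* c (suc m) 1 (2 ^ e) ⟩
    frac (c ℕ.* 1) (suc m ℕ.* 2 ^ e)
      ≡⟨ cong₂ frac (ℕ.*-identityʳ c) (cong (λ n → suc m ℕ.* 2 ^ n) (ℕ.*-comm (suc m) (K ℕ.+ 1))) ⟩
    epsTerm K (suc m) ∎
    where
    open ≡-Reasoning
    K = suc k
    e = suc m ℕ.* (K ℕ.+ 1)
    c = ((K ℕ.+ 1) ℕ.* suc m ∸ 2) C m
    instance
      _ = ℕ.m^n≢0 2 e

  twiceEpsPartial : ℕ → ℕ → ℚ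
  twiceEpsPartial k = sum1 (λ i → ℕ→ℚ 2 * epsTerm k i)

  lhsPartial≡2-twiceEpsPartial : ∀ k N → lhsPartial (suc k) N ≡ ℕ→ℚ 2 - twiceEpsPartial (suc k) N
  lhsPartial≡2-twiceEpsPartial k N =
    cong (λ x → ℕ→ℚ 2 - x) (trans (*-distribˡ-sum1 (ℕ→ℚ (2 ℕ.* K)) term N) (sum1-cong termwise N))
    where
    K = suc k
    term : ℕ → ℚ
    term m = b K (m ℕ.* K) * frac 1 (2 ^ (m ℕ.* (K ℕ.+ 1)))
    termwise : ∀ m → ℕ→ℚ (2 ℕ.* K) * term (suc m) ≡ ℕ→ℚ 2 * epsTerm K (suc m)
    termwise m = begin
      ℕ→ℚ (2 ℕ.* K) * term (suc m)      ≡⟨ cong (_* term (suc m)) (ℕ→ℚ-* 2 K) ⟩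
      ℕ→ℚ 2 * ℕ→ℚ K * term (suc m)      ≡⟨ *-assoc (ℕ→ℚ 2) (ℕ→ℚ K) (term (suc m)) ⟩
      ℕ→ℚ 2 * (ℕ→ℚ K * term (suc m))    ≡⟨ cong (ℕ→ℚ 2 *_) (k*b[mk]/2^[m[k+1]]≡epsTerm k m) ⟩
      ℕ→ℚ 2 * epsTerm K (suc m)         ∎
      where open ≡-Reasoning

  rhsPartial≡2-twiceEpsPartial : ∀ k N → rhsPartial k N ≡ ℕ→ℚ 2 - twiceEpsPartial k N
  rhsPartial≡2-twiceEpsPartial k N = begin
    ℕ→ℚ 2 * (1ℚ - epsPartial k N)
      ≡⟨ *-distribˡ-+ (ℕ→ℚ 2) 1ℚ (- epsPartial k N) ⟩
    ℕ→ℚ 2 * 1ℚ + ℕ→ℚ 2 * - epsPartial k N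
      ≡⟨ cong₂ _+_ (*-identityʳ (ℕ→ℚ 2)) (neg-distribʳ-* (ℕ→ℚ 2) (epsPartial k N)) ⟨
    ℕ→ℚ 2 - ℕ→ℚ 2 * epsPartial k N
      ≡⟨ cong (λ x → ℕ→ℚ 2 - x) (*-distribˡ-sum1 (ℕ→ℚ 2) (epsTerm k) N) ⟩
    ℕ→ℚ 2 - twiceEpsPartial k N ∎
    where open ≡-Reasoning

  lhsPartial≡rhsPartial : ∀ k N → lhsPartial (suc k) N ≡ rhsPartial (suc k) N
  lhsPartial≡rhsPartial k N =
    trans (lhsPartial≡2-twiceEpsPartial k N) (sym (rhsPartial≡2-twiceEpsPartial (suc k) N))

  x≤2*x : ∀ {x} → 0ℚ ≤ x → x ≤ ℕ→ℚ 2 * x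
  x≤2*x {x} 0≤x = subst (x ≤_) (sym (2*x≡x+x x)) (p≤p+q 0≤x)
    where
    -- ℕ→ℚ 2 and 1ℚ + 1ℚ evaluate to the same normal form.
    2*x≡x+x : ∀ x → ℕ→ℚ 2 * x ≡ x + x
    2*x≡x+x = solve 1 (λ x → (con 1ℚ :+ con 1ℚ) :* x := x :+ x) refl where open +-*-Solver

  0≤epsTerm : ∀ k i → 0ℚ ≤ epsTerm k i
  0≤epsTerm k i = 0≤frac (((k ℕ.+ 1) ℕ.* i ∸ 2) C (i ∸ 1)) (i ℕ.* 2 ^ ((k ℕ.+ 1) ℕ.* i))

  2*epsTerm≤1/[i[i+1]] : ∀ {k} t → 2 ℕ.≤ k → ℕ→ℚ 2 * epsTerm k (suc t) ≤ frac 1 (suc t ℕ.* suc (suc t))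
  2*epsTerm≤1/[i[i+1]] {k} t 2≤k =
    ≤-trans (≤-reflexive (frac-* 2 1 c d))
            (frac-mono-≤ (2 ℕ.* c) (1 ℕ.* d) 1 (suc t ℕ.* suc (suc t)) cross-multiplied)
    where
    e = (k ℕ.+ 1) ℕ.* suc t
    c = (e ∸ 2) C t
    d = suc t ℕ.* 2 ^ e
    instance
      _ = ℕ.m^n≢0 2 e
      _ = ℕ.m*n≢0 (suc t) (2 ^ e)
      _ = ℕ.m*n≢0 1 d
    cross-multiplied : 2 ℕ.* c ℕ.* (suc t ℕ.* suc (suc t)) ℕ.≤ 1 ℕ.* (1 ℕ.* d)
    cross-multiplied = begin
      2 ℕ.* c ℕ.* (suc t ℕ.* suc (suc t))    ≡⟨ shuffle t c ⟩
      suc t ℕ.* (2 ℕ.* (suc t ℕ.+ 1) ℕ.* c)  ≤⟨ ℕ.*-monoʳ-≤ (suc t) (fussCatalan-numerator-bound t 2≤k) ⟩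
      suc t ℕ.* 2 ^ e                        ≡⟨ shuffle′ (suc t ℕ.* 2 ^ e) ⟩
      1 ℕ.* (1 ℕ.* d)                        ∎
      where
      open ℕ.≤-Reasoning
      shuffle : ∀ t c → 2 ℕ.* c ℕ.* (suc t ℕ.* suc (suc t)) ≡ suc t ℕ.* (2 ℕ.* (suc t ℕ.+ 1) ℕ.* c)
      shuffle = solve-∀
      shuffle′ : ∀ d → d ≡ 1 ℕ.* (1 ℕ.* d)
      shuffle′ = solve-∀

  epsPartial-isCauchy : ∀ {k} → 2 ℕ.≤ k → IsCauchy (epsPartial k)
  epsPartial-isCauchy {k} 2≤k = sum1-isCauchy (epsTerm k) (0≤epsTerm k ∘ suc)
    (λ t → ≤-trans (x≤2*x (0≤epsTerm k (suc t))) (2*epsTerm≤1/[i[i+1]] t 2≤k))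

  rhsPartial-isCauchy : ∀ {k} → 2 ℕ.≤ k → IsCauchy (rhsPartial k)
  rhsPartial-isCauchy {k} 2≤k =
    IsCauchy-cong (sym ∘ rhsPartial≡2-twiceEpsPartial k)
      (IsCauchy-const-minus (ℕ→ℚ 2) {twiceEpsPartial k} twiceEpsPartial-isCauchy)
    where
    twiceEpsPartial-isCauchy : IsCauchy (twiceEpsPartial k)
    twiceEpsPartial-isCauchy = sum1-isCauchy (λ i → ℕ→ℚ 2 * epsTerm k i)
      (λ t → ≤-trans (0≤epsTerm k (suc t)) (x≤2*x (0≤epsTerm k (suc t))))
      (λ t → 2*epsTerm≤1/[i[i+1]] t 2≤k)

open import Data.Nat using (ℕ; _≤_; suc)
open import Data.Product using (_×_; _,_)
open import Function using (_∘_)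
open import Relation.Binary.PropositionalEquality using (sym)

open Series using (IsCauchy-cong; ≗⇒SameLimit)
open FussCatalan using (lhsPartial≡rhsPartial; epsPartial-isCauchy; rhsPartial-isCauchy)

mainTheorem1 : (k : ℕ) → 2 ≤ k →
    IsCauchy (lhsPartial k) × IsCauchy (epsPartial k) × SameLimit (lhsPartial k) (rhsPartial k)
mainTheorem1 k@(suc k-1) 2≤k =
    IsCauchy-cong (sym ∘ lhsPartial≡rhsPartial k-1) (rhsPartial-isCauchy 2≤k)
  , epsPartial-isCauchy 2≤k
  , ≗⇒SameLimit (lhsPartial≡rhsPartial k-1)
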